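{- Let $\langle A;\cdot,0,\Diamond\rangle$ be a monadic quasi-implication algebra and let $\preceq$ be the partial order on $A$ given by $x\preceq y$ iff $x\cdot y=1$. Then for all $x,y\in A$, $x\preceq y$ implies $\Diamond x\preceq\Diamond y$.
   Context: A quasi-implication algebra is a magma $\langle A;\cdot\rangle$ satisfying, for all $x,y,z$: (1) $(x\cdot y)\cdot x=x$; (2) $(x\cdot y)\cdot(x\cdot z)=(y\cdot x)\cdot(y\cdot z)$; (3) $((x\cdot y)\cdot(y\cdot x))\cdot x=((y\cdot x)\cdot(x\cdot y))\cdot y$. In any quasi-implication algebra $x\cdot x=y\cdot y$ for all $x,y$, and $1$ denotes this common element. A bounded quasi-implication algebra is a quasi-implication algebra with a distinguished element $0$ such that $0\cdot x=1$ for all $x$. A monadic quasi-implication algebra is an algebra $\langle A;\cdot,0,\Diamond\rangle$ such that $\langle A;\cdot,0\rangle$ is a bounded quasi-implication algebra and $\Diamond\colon A\to A$ satisfies, for all $x,y$: (a) $\Diamond\Diamond x\cdot\Diamond x=1$ and $x\cdot\Diamond x=1$; (b) $\Diamond(\Diamond x\cdot 0)=\Diamond x\cdot 0$ and $\Diamond 0=0$; (c) $\Diamond(((x\cdot 0)\cdot(y\cdot 0))\cdot x)=((\Diamond x\cdot 0)\cdot(\Diamond y\cdot 0))\cdot\Diamond x$. The order $\preceq$ is the lattice order of the orthomodular lattice induced by the bounded quasi-implication algebra. -}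

module Defs where

open import Level using (Level)
open import Relation.Binary.PropositionalEquality using (_≡_)

record IsQuasiImplicationAlgebra {a : Level} {A : Set a} (_·_ : A → A → A) : Set a where
  field
    absorb  : ∀ x y → (x · y) · x ≡ x
    exch    : ∀ x y z → (x · y) · (x · z) ≡ (y · x) · (y · z)
    qimpl3  : ∀ x y → ((x · y) · (y · x)) · x ≡ ((y · x) · (x · y)) · y

-- The constant 1: in any quasi-implication algebra x·x = y·y for all x,y,
-- so we take 1 to be 0·0 (any x·x would give the same element).

record IsMonadicQIA {a : Level} {A : Set a} (_·_ : A → A → A) (𝟘 : A) (◇ : A → A) : Set a where
  𝟙 : A
  𝟙 = 𝟘 · 𝟘
  field
    isQIA   : IsQuasiImplicationAlgebra _·_
    bottom  : ∀ x → 𝟘 · x ≡ 𝟙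
    ax-a1   : ∀ x → ◇ (◇ x) · ◇ x ≡ 𝟙
    ax-a2   : ∀ x → x · ◇ x ≡ 𝟙
    ax-b1   : ∀ x → ◇ (◇ x · 𝟘) ≡ ◇ x · 𝟘
    ax-b2   : ◇ 𝟘 ≡ 𝟘
    ax-c    : ∀ x y → ◇ (((x · 𝟘) · (y · 𝟘)) · x) ≡ ((◇ x · 𝟘) · (◇ y · 𝟘)) · ◇ x

_⪯⟨_,_⟩_ : {a : Level} {A : Set a} → A → (A → A → A) → A → A → Set a
x ⪯⟨ _·_ , 𝟘 ⟩ y = x · y ≡ 𝟘 · 𝟘

-- Writing ¬x for x · 0, the hypothesis x · y = 1 contraposes to ¬y · ¬x = 1, so
-- y = ((¬y · ¬x) · y). Axiom (c) carries this identity through ◇, giving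
-- ◇y = (¬◇y · ¬◇x) · ◇y, and ◇x · ((¬◇y · ¬◇x) · ◇y) = 1 holds for arbitrary
-- elements of a bounded quasi-implication algebra.
module Submission where

open import Defs
open import Level using (Level)
open import Relation.Binary.PropositionalEquality
open ≡-Reasoning

module QuasiImplicationAlgebraProperties
  {a : Level} {A : Set a} {_·_ : A → A → A} (isQIA : IsQuasiImplicationAlgebra _·_) where

  open IsQuasiImplicationAlgebra isQIA

  x·[x·y]≡x·y : ∀ x y → x · (x · y) ≡ x · y
  x·[x·y]≡x·y x y = begin
    x · (x · y)             ≡⟨ cong (_· (x · y)) (sym (absorb x y)) ⟩
    ((x · y) · x) · (x · y) ≡⟨ absorb (x · y) x ⟩
    x · y                   ∎

  x·[[x·y]·z]≡[x·y]·[x·z] : ∀ x y z → x · ((x · y) · z) ≡ (x · y) · (x · z)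
  x·[[x·y]·z]≡[x·y]·[x·z] x y z = begin
    x · ((x · y) · z)             ≡⟨ cong (_· ((x · y) · z)) (sym (absorb x y)) ⟩
    ((x · y) · x) · ((x · y) · z) ≡⟨ exch (x · y) x z ⟩
    (x · (x · y)) · (x · z)       ≡⟨ cong (_· (x · z)) (x·[x·y]≡x·y x y) ⟩
    (x · y) · (x · z)             ∎

  x·[[x·[y·z]]·y]≡[[y·z]·x]·y : ∀ x y z → x · ((x · (y · z)) · y) ≡ ((y · z) · x) · y
  x·[[x·[y·z]]·y]≡[[y·z]·x]·y x y z = begin
    x · ((x · (y · z)) · y)             ≡⟨ x·[[x·y]·z]≡[x·y]·[x·z] x (y · z) y ⟩
    (x · (y · z)) · (x · y)             ≡⟨ exch x (y · z) y ⟩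
    ((y · z) · x) · ((y · z) · y)       ≡⟨ cong (((y · z) · x) ·_) (absorb y z) ⟩
    ((y · z) · x) · y                   ∎

module BoundedQuasiImplicationAlgebraProperties
  {a : Level} {A : Set a} {_·_ : A → A → A} {𝟘 : A}
  (isQIA : IsQuasiImplicationAlgebra _·_) (bottom : ∀ x → 𝟘 · x ≡ 𝟘 · 𝟘) where

  open IsQuasiImplicationAlgebra isQIA
  open QuasiImplicationAlgebraProperties isQIA

  𝟙 : A
  𝟙 = 𝟘 · 𝟘

  𝟙·𝟘≡𝟘 : 𝟙 · 𝟘 ≡ 𝟘
  𝟙·𝟘≡𝟘 = absorb 𝟘 𝟘

  [x·𝟘]·[x·y]≡𝟙·𝟙 : ∀ x y → (x · 𝟘) · (x · y) ≡ 𝟙 · 𝟙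
  [x·𝟘]·[x·y]≡𝟙·𝟙 x y = begin
    (x · 𝟘) · (x · y) ≡⟨ sym (exch 𝟘 x y) ⟩
    (𝟘 · x) · (𝟘 · y) ≡⟨ cong₂ _·_ (bottom x) (bottom y) ⟩
    𝟙 · 𝟙             ∎

  𝟙·𝟙≡𝟙 : 𝟙 · 𝟙 ≡ 𝟙
  𝟙·𝟙≡𝟙 = begin
    𝟙 · 𝟙             ≡⟨ sym ([x·𝟘]·[x·y]≡𝟙·𝟙 𝟙 𝟘) ⟩
    (𝟙 · 𝟘) · (𝟙 · 𝟘) ≡⟨ cong₂ _·_ 𝟙·𝟘≡𝟘 𝟙·𝟘≡𝟘 ⟩
    𝟙                 ∎

  [x·𝟘]·[x·y]≡𝟙 : ∀ x y → (x · 𝟘) · (x · y) ≡ 𝟙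
  [x·𝟘]·[x·y]≡𝟙 x y = trans ([x·𝟘]·[x·y]≡𝟙·𝟙 x y) 𝟙·𝟙≡𝟙

  x·[[x·𝟘]·y]≡𝟙 : ∀ x y → x · ((x · 𝟘) · y) ≡ 𝟙
  x·[[x·𝟘]·y]≡𝟙 x y = trans (x·[[x·y]·z]≡[x·y]·[x·z] x 𝟘 y) ([x·𝟘]·[x·y]≡𝟙 x y)

  x·𝟙≡𝟙 : ∀ x → x · 𝟙 ≡ 𝟙
  x·𝟙≡𝟙 x = begin
    x · 𝟙                   ≡⟨ cong (x ·_) (sym ([x·𝟘]·[x·y]≡𝟙 x 𝟘)) ⟩
    x · ((x · 𝟘) · (x · 𝟘)) ≡⟨ x·[[x·𝟘]·y]≡𝟙 x (x · 𝟘) ⟩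
    𝟙                       ∎

  𝟙·x≡x : ∀ x → 𝟙 · x ≡ x
  𝟙·x≡x x = trans (cong (_· x) (sym (x·𝟙≡𝟙 x))) (absorb x 𝟙)

  x·y≡𝟙⇒[y·𝟘]·[x·𝟘]≡𝟙 : ∀ {x y} → x · y ≡ 𝟙 → (y · 𝟘) · (x · 𝟘) ≡ 𝟙
  x·y≡𝟙⇒[y·𝟘]·[x·𝟘]≡𝟙 {x} {y} x·y≡𝟙 = begin
    (y · 𝟘) · (x · 𝟘)               ≡⟨ cong ((y · 𝟘) ·_) (sym (𝟙·x≡x (x · 𝟘))) ⟩
    (y · 𝟘) · (𝟙 · (x · 𝟘))         ≡⟨ cong (λ t → (y · 𝟘) · (t · (x · 𝟘))) (sym x·y≡𝟙) ⟩
    (y · 𝟘) · ((x · y) · (x · 𝟘))   ≡⟨ cong ((y · 𝟘) ·_) (exch x y 𝟘) ⟩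
    (y · 𝟘) · ((y · x) · (y · 𝟘))   ≡⟨ cong ((y · 𝟘) ·_) (sym (x·[[x·y]·z]≡[x·y]·[x·z] y x 𝟘)) ⟩
    (y · 𝟘) · (y · ((y · x) · 𝟘))   ≡⟨ [x·𝟘]·[x·y]≡𝟙 y ((y · x) · 𝟘) ⟩
    𝟙                               ∎

  y·[[[x·z]·[y·𝟘]]·x]≡𝟙 : ∀ x y z → y · (((x · z) · (y · 𝟘)) · x) ≡ 𝟙
  y·[[[x·z]·[y·𝟘]]·x]≡𝟙 x y z = begin
    y · (((x · z) · (y · 𝟘)) · x)
      ≡⟨ cong (y ·_) (sym (x·[[x·[y·z]]·y]≡[[y·z]·x]·y (y · 𝟘) x z)) ⟩
    y · ((y · 𝟘) · (((y · 𝟘) · (x · z)) · x))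
      ≡⟨ x·[[x·𝟘]·y]≡𝟙 y (((y · 𝟘) · (x · z)) · x) ⟩
    𝟙 ∎

proposition5p4 : {a : Level} {A : Set a} (_·_ : A → A → A) (𝟘 : A) (◇ : A → A)
    → IsMonadicQIA _·_ 𝟘 ◇
    → ∀ x y → x ⪯⟨ _·_ , 𝟘 ⟩ y → ◇ x ⪯⟨ _·_ , 𝟘 ⟩ ◇ y
proposition5p4 _·_ 𝟘 ◇ M x y x⪯y = begin
  ◇ x · ◇ y                                   ≡⟨ cong (◇ x ·_) ◇y≡[¬◇y·¬◇x]·◇y ⟩
  ◇ x · (((◇ y · 𝟘) · (◇ x · 𝟘)) · ◇ y)       ≡⟨ y·[[[x·z]·[y·𝟘]]·x]≡𝟙 (◇ y) (◇ x) 𝟘 ⟩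
  𝟘 · 𝟘                                       ∎
  where
  open IsMonadicQIA M using (isQIA; bottom; ax-c)
  open BoundedQuasiImplicationAlgebraProperties isQIA bottom

  ◇y≡[¬◇y·¬◇x]·◇y : ◇ y ≡ ((◇ y · 𝟘) · (◇ x · 𝟘)) · ◇ y
  ◇y≡[¬◇y·¬◇x]·◇y = begin
    ◇ y                             ≡⟨ cong ◇ (sym (𝟙·x≡x y)) ⟩
    ◇ (𝟙 · y)                       ≡⟨ cong (λ t → ◇ (t · y)) (sym (x·y≡𝟙⇒[y·𝟘]·[x·𝟘]≡𝟙 x⪯y)) ⟩
    ◇ (((y · 𝟘) · (x · 𝟘)) · y)     ≡⟨ ax-c y x ⟩
    ((◇ y · 𝟘) · (◇ x · 𝟘)) · ◇ y   ∎
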